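{- Let $G$ be a graph, let $F$ be a minimum feedback edge set of $G$, and let $D$ be the set of endpoints of edges of $F$. Let $r \ge 1$ and $s \ge 1$ be integers. Then: (i) every vertex $v \in V(G) \setminus D$ belongs to at most $\mathsf{fes}(G)$ triangles of $G$; and (ii) if $r > \mathsf{fes}(G)$, then every set $S \subseteq V(G)$ that is an $s$-club satisfying the vertex $r$-triangle property has at most $2\,\mathsf{fes}(G)$ vertices and satisfies $S \subseteq D$.
   Context: All graphs are finite, simple and undirected. A feedback edge set of $G$ is $F \subseteq E(G)$ such that $G - F$ is a forest; $\mathsf{fes}(G)$ is the minimum size of a feedback edge set. A set $S \subseteq V(G)$ is an $s$-club if $G[S]$ has diameter at most $s$. A set $S$ satisfies the vertex $r$-triangle property if every $v \in S$ belongs to at least $r$ triangles of $G[S]$. -}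

module Defs where

open import Data.Nat using (ℕ; zero; suc; _+_; _≤_; _<ᵇ_)
open import Data.Nat.ListAction using (sum)
open import Data.Bool using (Bool; true; false; _∧_; not; if_then_else_)
open import Data.Fin using (Fin; toℕ)
open import Data.Vec using (lookup)
open import Data.Fin.Subset using (Subset; _∈_; _⊆_)
open import Data.List using (List; []; _∷_; _∷ʳ_; length; map; allFin)
open import Data.List.Relation.Unary.Unique.Propositional using (Unique)
open import Data.Product using (Σ; ∃; _×_)
open import Relation.Binary.PropositionalEquality using (_≡_)
open import Relation.Nullary using (¬_)

record Graph (n : ℕ) : Set where
  field
    adj   : Fin n → Fin n → Bool
    sym   : ∀ i j → adj i j ≡ adj j i
    irref : ∀ i → adj i i ≡ false
open Graph public

EdgeSet : ℕ → Set
EdgeSet n = Fin n → Fin n → Bool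

count : ∀ {n} → (Fin n → Bool) → ℕ
count {n} p = sum (map (λ i → if p i then 1 else 0) (allFin n))

countPairs : ∀ {n} → (Fin n → Fin n → Bool) → ℕ
countPairs P = sum (map (λ i → count (λ j → (toℕ i <ᵇ toℕ j) ∧ P i j)) (allFin _))

size : ∀ {n} → EdgeSet n → ℕ
size = countPairs

data Chain {n} (A : Fin n → Fin n → Bool) : List (Fin n) → Set where
  []  : Chain A []
  [_] : ∀ x → Chain A (x ∷ [])
  _∷_ : ∀ {x y ys} → A x y ≡ true → Chain A (y ∷ ys) → Chain A (x ∷ y ∷ ys)

HasCycle : ∀ {n} → (Fin n → Fin n → Bool) → Set
HasCycle {n} A = Σ (Fin n) λ x → Σ (List (Fin n)) λ ys →
  Unique (x ∷ ys) × (2 ≤ length ys) × Chain A (x ∷ ys ∷ʳ x)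

IsForestRel : ∀ {n} → (Fin n → Fin n → Bool) → Set
IsForestRel A = ¬ HasCycle A

removeEdges : ∀ {n} → Graph n → EdgeSet n → Fin n → Fin n → Bool
removeEdges G F i j = adj G i j ∧ not (F i j)

IsFES : ∀ {n} → Graph n → EdgeSet n → Set
IsFES G F = (∀ i j → F i j ≡ F j i)
          × (∀ i j → F i j ≡ true → adj G i j ≡ true)
          × IsForestRel (removeEdges G F)

-- F is a minimum feedback edge set (then fes(G) = size F)
IsMinFES : ∀ {n} → Graph n → EdgeSet n → Set
IsMinFES G F = IsFES G F × (∀ F' → IsFES G F' → size F ≤ size F')

endpoints : ∀ {n} → EdgeSet n → Fin n → Set
endpoints {n} F v = ∃ λ (u : Fin n) → F v u ≡ true

induced : ∀ {n} → Graph n → Subset n → Fin n → Fin n → Bool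
induced G S i j = adj G i j ∧ lookup S i ∧ lookup S j

triangles : ∀ {n} → (Fin n → Fin n → Bool) → Fin n → ℕ
triangles A v = countPairs (λ u w → A v u ∧ A v w ∧ A u w)

data Walk {n} (A : Fin n → Fin n → Bool) : Fin n → Fin n → ℕ → Set where
  here : ∀ {u} → Walk A u u zero
  step : ∀ {u w v k} → A u w ≡ true → Walk A w v k → Walk A u v (suc k)

IsClub : ∀ {n} → Graph n → ℕ → Subset n → Set
IsClub {n} G s S = ∀ (u v : Fin n) → u ∈ S → v ∈ S →
  ∃ λ k → k ≤ s × Walk (induced G S) u v k

VertexTriangleProp : ∀ {n} → Graph n → ℕ → Subset n → Set
VertexTriangleProp {n} G r S = ∀ (v : Fin n) → v ∈ S → r ≤ triangles (induced G S) v

-- A triangle v u w through a vertex v that is not incident to F is a cycle of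
-- length three; since G - F is a forest, one of its edges lies in F, and it can
-- only be u w. So the triangles at v inject into F. If every vertex of S lies in
-- more than |F| triangles, no vertex of S can avoid the endpoints of F, and by the
-- handshake lemma F has at most 2|F| endpoints.
module Submission where

open import Defs
open import Data.Nat using (ℕ; zero; suc; _+_; _*_; _≤_; _<_; _<ᵇ_; z≤n; s≤s)
open import Data.Nat.Properties
  using (+-0-commutativeMonoid; +-identityʳ; +-mono-≤; ≤-refl; ≤-trans; ≤-antisym;
         ≤-reflexive; m≤m+n; m≤n+m; <-asym; ≮⇒≥; <ᵇ-reflects-<; <⇒≱)
import Data.Nat.ListAction as List
open import Data.Bool using (Bool; true; false; _∧_; if_then_else_)
open import Data.Bool.Properties using (_≟_)
open import Data.Fin using (Fin; zero; suc; toℕ)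
open import Data.Fin.Properties using (toℕ-injective; any?)
open import Data.Fin.Subset using (Subset; _∈_; ∣_∣)
open import Data.Vec using ([]; _∷_; lookup)
open import Data.Vec.Properties using (lookup⇒[]=)
open import Data.List using ([]; _∷_; map; allFin; tabulate)
open import Data.List.Properties using (map-tabulate)
open import Data.List.Relation.Unary.All using ([]; _∷_)
open import Data.List.Relation.Unary.AllPairs using ([]; _∷_)
open import Data.Product using (_×_; _,_; proj₁)
open import Data.Empty using (⊥-elim)
open import Function using (id; _∘_)
open import Relation.Binary.PropositionalEquality as ≡ using (_≡_; _≢_; refl; trans; cong; subst)
open import Relation.Nullary using (¬_; yes; no; ofʸ; ofⁿ)
open import Algebra.Properties.CommutativeMonoid.Sum +-0-commutativeMonoid
  using (sum-syntax; sum-cong-≗; ∑-distrib-+; ∑-comm)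

indicator : Bool → ℕ
indicator b = if b then 1 else 0

indicator-mono : ∀ {a b} → (a ≡ true → b ≡ true) → indicator a ≤ indicator b
indicator-mono {false} _ = z≤n
indicator-mono {true} a⇒b rewrite a⇒b refl = ≤-refl

∧-≡-true : ∀ {a b} → a ∧ b ≡ true → a ≡ true × b ≡ true
∧-≡-true {true} b≡true = refl , b≡true

∧-≡-true₃ : ∀ {a b c} → a ∧ b ∧ c ≡ true → a ≡ true × b ≡ true × c ≡ true
∧-≡-true₃ {true} bc = refl , ∧-≡-true bc

∧-≡-true⁻¹ : ∀ {a b} → a ≡ true → b ≡ true → a ∧ b ≡ true
∧-≡-true⁻¹ refl b≡true = b≡true

∑-mono-≤ : ∀ {n} {f g : Fin n → ℕ} → (∀ i → f i ≤ g i) →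
  (∑[ i < n ] f i) ≤ (∑[ i < n ] g i)
∑-mono-≤ {zero} _ = z≤n
∑-mono-≤ {suc n} f≤g = +-mono-≤ (f≤g zero) (∑-mono-≤ (f≤g ∘ suc))

term≤∑ : ∀ {n} (f : Fin n → ℕ) i → f i ≤ (∑[ j < n ] f j)
term≤∑ f zero = m≤m+n (f zero) _
term≤∑ f (suc i) = ≤-trans (term≤∑ (f ∘ suc) i) (m≤n+m _ (f zero))

sum-map-allFin : ∀ {n} (f : Fin n → ℕ) → List.sum (map f (allFin n)) ≡ (∑[ i < n ] f i)
sum-map-allFin {n} f = trans (cong List.sum (map-tabulate id f)) (sum-tabulate f)
  where
  sum-tabulate : ∀ {m} (g : Fin m → ℕ) → List.sum (tabulate g) ≡ (∑[ i < m ] g i)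
  sum-tabulate {zero} g = refl
  sum-tabulate {suc m} g = cong (g zero +_) (sum-tabulate (g ∘ suc))

count≡∑ : ∀ {n} (p : Fin n → Bool) → count p ≡ (∑[ i < n ] indicator (p i))
count≡∑ p = sum-map-allFin (indicator ∘ p)

countPairs≡∑∑ : ∀ {n} (P : Fin n → Fin n → Bool) →
  countPairs P ≡ (∑[ i < n ] ∑[ j < n ] indicator ((toℕ i <ᵇ toℕ j) ∧ P i j))
countPairs≡∑∑ {n} P = trans (sum-map-allFin λ i → count (pairsFrom i))
                         (sum-cong-≗ λ i → count≡∑ (pairsFrom i))
  where
  pairsFrom : Fin n → Fin n → Bool
  pairsFrom i j = (toℕ i <ᵇ toℕ j) ∧ P i j

∣S∣≡∑ : ∀ {n} (S : Subset n) → ∣ S ∣ ≡ (∑[ i < n ] indicator (lookup S i))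
∣S∣≡∑ [] = refl
∣S∣≡∑ (true ∷ S) = cong suc (∣S∣≡∑ S)
∣S∣≡∑ (false ∷ S) = ∣S∣≡∑ S

count-pos : ∀ {n} (p : Fin n → Bool) {u} → p u ≡ true → 1 ≤ count p
count-pos p {u} pu rewrite count≡∑ p =
  subst (_≤ _) (cong indicator pu) (term≤∑ (indicator ∘ p) u)

countPairs-mono : ∀ {n} {P Q : Fin n → Fin n → Bool} →
  (∀ i j → P i j ≡ true → Q i j ≡ true) → countPairs P ≤ countPairs Q
countPairs-mono {P = P} {Q} P⇒Q rewrite countPairs≡∑∑ P | countPairs≡∑∑ Q =
  ∑-mono-≤ λ i → ∑-mono-≤ λ j → indicator-mono (restrict i j)
  where
  restrict : ∀ i j → (toℕ i <ᵇ toℕ j) ∧ P i j ≡ true → (toℕ i <ᵇ toℕ j) ∧ Q i j ≡ true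
  restrict i j i<j∧P with ∧-≡-true {toℕ i <ᵇ toℕ j} i<j∧P
  ... | i<j , Pij rewrite i<j = P⇒Q i j Pij

indicator-split : ∀ {n} (i j : Fin n) b → (i ≡ j → b ≡ false) →
  indicator b ≡ indicator ((toℕ i <ᵇ toℕ j) ∧ b) + indicator ((toℕ j <ᵇ toℕ i) ∧ b)
indicator-split i j b i≡j⇒¬b
  with toℕ i <ᵇ toℕ j | <ᵇ-reflects-< (toℕ i) (toℕ j)
     | toℕ j <ᵇ toℕ i | <ᵇ-reflects-< (toℕ j) (toℕ i)
... | true  | ofʸ i<j  | true  | ofʸ j<i = ⊥-elim (<-asym i<j j<i)
... | true  | _        | false | _       = ≡.sym (+-identityʳ _)
... | false | _        | true  | _       = refl
... | false | ofⁿ i≮j | false | ofⁿ j≮i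
  rewrite i≡j⇒¬b (toℕ-injective (≤-antisym (≮⇒≥ j≮i) (≮⇒≥ i≮j))) = refl

handshake : ∀ {n} (F : EdgeSet n) → (∀ i j → F i j ≡ F j i) → (∀ i → F i i ≡ false) →
  (∑[ v < n ] count (F v)) ≡ 2 * size F
handshake {n} F F-sym F-irrefl = begin
  ∑[ v < n ] count (F v)
    ≡⟨ sum-cong-≗ (λ v → count≡∑ (F v)) ⟩
  ∑[ v < n ] ∑[ u < n ] indicator (F v u)
    ≡⟨ sum-cong-≗ (λ v → sum-cong-≗ λ u → indicator-split v u (F v u) λ { refl → F-irrefl v }) ⟩
  ∑[ v < n ] ∑[ u < n ] (forward v u + backward v u)
    ≡⟨ sum-cong-≗ (λ v → ∑-distrib-+ (forward v) (backward v)) ⟩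
  ∑[ v < n ] ((∑[ u < n ] forward v u) + (∑[ u < n ] backward v u))
    ≡⟨ ∑-distrib-+ (λ v → ∑[ u < n ] forward v u) (λ v → ∑[ u < n ] backward v u) ⟩
  (∑[ v < n ] ∑[ u < n ] forward v u) + (∑[ v < n ] ∑[ u < n ] backward v u)
    ≡⟨ cong ((∑[ v < n ] ∑[ u < n ] forward v u) +_) (trans (∑-comm backward) (sum-cong-≗ λ u → sum-cong-≗ λ v →
         cong (λ b → indicator ((toℕ u <ᵇ toℕ v) ∧ b)) (F-sym v u))) ⟩
  (∑[ v < n ] ∑[ u < n ] forward v u) + (∑[ v < n ] ∑[ u < n ] forward v u)
    ≡⟨ cong (λ m → m + m) (≡.sym (countPairs≡∑∑ F)) ⟩
  size F + size F
    ≡⟨ cong (size F +_) (≡.sym (+-identityʳ (size F))) ⟩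
  2 * size F ∎
  where
  open ≡.≡-Reasoning
  forward backward : Fin n → Fin n → ℕ
  forward v u = indicator ((toℕ v <ᵇ toℕ u) ∧ F v u)
  backward v u = indicator ((toℕ u <ᵇ toℕ v) ∧ F v u)

∣S∣≤∑degree : ∀ {n} (F : EdgeSet n) (S : Subset n) →
  (∀ v → v ∈ S → endpoints F v) → ∣ S ∣ ≤ (∑[ v < n ] count (F v))
∣S∣≤∑degree F S S⊆ends rewrite ∣S∣≡∑ S = ∑-mono-≤ member≤degree
  where
  member≤degree : ∀ v → indicator (lookup S v) ≤ count (F v)
  member≤degree v with lookup S v in v∈S
  ... | false = z≤n
  ... | true with S⊆ends v (lookup⇒[]= v S v∈S)
  ...   | _ , Fvu = count-pos (F v) Fvu

triangle⇒HasCycle : ∀ {n} {A : Fin n → Fin n → Bool} {x y z : Fin n} →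
  x ≢ y → x ≢ z → y ≢ z → A x y ≡ true → A y z ≡ true → A z x ≡ true → HasCycle A
triangle⇒HasCycle {x = x} {y} {z} x≢y x≢z y≢z xy yz zx =
  x , y ∷ z ∷ [] , (x≢y ∷ x≢z ∷ []) ∷ (y≢z ∷ []) ∷ [] ∷ [] , s≤s (s≤s z≤n) , xy ∷ yz ∷ zx ∷ [ x ]

adj⇒≢ : ∀ {n} (G : Graph n) {a b} → adj G a b ≡ true → a ≢ b
adj⇒≢ G {a} ab refl with () ← trans (≡.sym (irref G a)) ab

feedback-irreflexive : ∀ {n} (G : Graph n) F → IsFES G F → ∀ i → F i i ≡ false
feedback-irreflexive G F (_ , F⊆G , _) i with F i i in Fii
... | false = refl
... | true = ⊥-elim (adj⇒≢ G (F⊆G i i Fii) refl)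

triangle-meets-feedback : ∀ {n} (G : Graph n) F → IsFES G F → ∀ {v u w} →
  adj G v u ≡ true → adj G v w ≡ true → adj G u w ≡ true →
  F v u ≡ false → F v w ≡ false → F u w ≡ true
triangle-meets-feedback G F (F-sym , _ , acyclic) {v} {u} {w} vu vw uw ¬Fvu ¬Fvw
  with F u w in Fuw
... | true = refl
... | false = ⊥-elim (acyclic (triangle⇒HasCycle (adj⇒≢ G vu) (adj⇒≢ G vw) (adj⇒≢ G uw)
                 (keep vu ¬Fvu) (keep uw Fuw)
                 (keep (trans (Graph.sym G w v) vw) (trans (F-sym w v) ¬Fvw))))
  where
  keep : ∀ {a b} → adj G a b ≡ true → F a b ≡ false → removeEdges G F a b ≡ true
  keep ab ¬Fab rewrite ab | ¬Fab = refl

¬endpoint⇒F≡false : ∀ {n} (F : EdgeSet n) {v} → ¬ endpoints F v → ∀ u → F v u ≡ false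
¬endpoint⇒F≡false F {v} v∉D u with F v u in Fvu
... | false = refl
... | true = ⊥-elim (v∉D (u , Fvu))

triangles≤size : ∀ {n} (G : Graph n) F → IsFES G F →
  ∀ v → ¬ endpoints F v → triangles (adj G) v ≤ size F
triangles≤size G F fes v v∉D = countPairs-mono λ u w triangle →
  let vu , vw , uw = ∧-≡-true₃ triangle
  in triangle-meets-feedback G F fes vu vw uw
       (¬endpoint⇒F≡false F v∉D u) (¬endpoint⇒F≡false F v∉D w)

triangles-mono : ∀ {n} {A B : Fin n → Fin n → Bool} → (∀ i j → A i j ≡ true → B i j ≡ true) →
  ∀ v → triangles A v ≤ triangles B v
triangles-mono A⇒B v = countPairs-mono λ u w triangle →
  let vu , vw , uw = ∧-≡-true₃ triangle
  in ∧-≡-true⁻¹ (A⇒B v u vu) (∧-≡-true⁻¹ (A⇒B v w vw) (A⇒B u w uw))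

induced⊆adj : ∀ {n} (G : Graph n) (S : Subset n) i j → induced G S i j ≡ true → adj G i j ≡ true
induced⊆adj G S i j = proj₁ ∘ ∧-≡-true

many-triangles⇒endpoint : ∀ {n} (G : Graph n) F → IsFES G F → ∀ {r} S →
  size F < r → VertexTriangleProp G r S → ∀ v → v ∈ S → endpoints F v
many-triangles⇒endpoint G F fes S |F|<r dense v v∈S
  with any? (λ u → F v u ≟ true)
... | yes v∈D = v∈D
... | no v∉D = ⊥-elim (<⇒≱ |F|<r (≤-trans (dense v v∈S)
                 (≤-trans (triangles-mono (induced⊆adj G S) v) (triangles≤size G F fes v v∉D))))

endpoints≤2*size : ∀ {n} (G : Graph n) F → IsFES G F →
  ∀ S → (∀ v → v ∈ S → endpoints F v) → ∣ S ∣ ≤ 2 * size F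
endpoints≤2*size G F fes@(F-sym , _) S S⊆D =
  ≤-trans (∣S∣≤∑degree F S S⊆D) (≤-reflexive (handshake F F-sym (feedback-irreflexive G F fes)))

lemma3 : ∀ {n} (G : Graph n) (F : EdgeSet n) → IsMinFES G F →
    ∀ (r s : ℕ) → 1 ≤ r → 1 ≤ s →
      (∀ (v : Fin n) → ¬ endpoints F v → triangles (adj G) v ≤ size F)
      × (size F < r → ∀ (S : Subset n) → IsClub G s S → VertexTriangleProp G r S →
          (∣ S ∣ ≤ 2 * size F) × (∀ (v : Fin n) → v ∈ S → endpoints F v))
lemma3 G F (fes , _) r s _ _ = triangles≤size G F fes , λ |F|<r S _ dense →
  let S⊆D = many-triangles⇒endpoint G F fes S |F|<r dense
  in endpoints≤2*size G F fes S S⊆D , S⊆D
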